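{- Let $a,b$ be coprime integers. Then $\phi_1(a,b)$ and $\phi_2(a,b)$ are coprime outside $5$: every prime ideal of the ring of integers of $\mathbb{Q}(\sqrt{5})$ dividing both $\phi_1(a,b)$ and $\phi_2(a,b)$ lies above $5$.
   Context: $\omega = \frac{ -1+\sqrt{5}}{2}$, $\bar{\omega} = \frac{ -1-\sqrt{5}}{2}$, $\phi_1(x,y) = x^2 + \omega xy + y^2$, $\phi_2(x,y) = x^2 + \bar{\omega}xy + y^2$. -}

module Defs where

-- The ring of integers of Q(√5) is ℤ[ω], ω = (-1+√5)/2, with ω² + ω - 1 = 0.
-- An element x + y·ω is represented by the pair (x , y) of integers.

open import Data.Integer as ℤ using (ℤ; +_; -[1+_])
open import Data.Product using (_×_; _,_)
open import Data.Sum using (_⊎_)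
open import Relation.Nullary using (¬_)

record 𝒪 : Set where
  constructor _+_ω
  field
    re : ℤ
    im : ℤ
open 𝒪 public

infixl 6 _⊕_
infixl 7 _⊗_

_⊕_ : 𝒪 → 𝒪 → 𝒪
(x₁ + y₁ ω) ⊕ (x₂ + y₂ ω) = (x₁ ℤ.+ x₂) + (y₁ ℤ.+ y₂) ω

⊖_ : 𝒪 → 𝒪
⊖ (x + y ω) = (ℤ.- x) + (ℤ.- y) ω

-- (x₁ + y₁ω)(x₂ + y₂ω) using ω² = 1 - ω
_⊗_ : 𝒪 → 𝒪 → 𝒪
(x₁ + y₁ ω) ⊗ (x₂ + y₂ ω) =
  (x₁ ℤ.* x₂ ℤ.+ y₁ ℤ.* y₂) + (x₁ ℤ.* y₂ ℤ.+ y₁ ℤ.* x₂ ℤ.- y₁ ℤ.* y₂) ω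

⟦_⟧ : ℤ → 𝒪
⟦ n ⟧ = n + (+ 0) ω

0𝒪 1𝒪 : 𝒪
0𝒪 = ⟦ + 0 ⟧
1𝒪 = ⟦ + 1 ⟧

-- ω = (-1+√5)/2 and its conjugate ω̄ = (-1-√5)/2 = -1 - ω
ω : 𝒪
ω = (+ 0) + (+ 1) ω

ω̄ : 𝒪
ω̄ = ⊖ 1𝒪 ⊕ ⊖ ω

φ₁ φ₂ : ℤ → ℤ → 𝒪
φ₁ a b = ⟦ a ⟧ ⊗ ⟦ a ⟧ ⊕ ω ⊗ ⟦ a ⟧ ⊗ ⟦ b ⟧ ⊕ ⟦ b ⟧ ⊗ ⟦ b ⟧
φ₂ a b = ⟦ a ⟧ ⊗ ⟦ a ⟧ ⊕ ω̄ ⊗ ⟦ a ⟧ ⊗ ⟦ b ⟧ ⊕ ⟦ b ⟧ ⊗ ⟦ b ⟧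

record IsIdeal (P : 𝒪 → Set) : Set where
  field
    zero-mem : P 0𝒪
    add-mem  : ∀ {x y} → P x → P y → P (x ⊕ y)
    mul-mem  : ∀ r {x} → P x → P (r ⊗ x)

record IsPrimeIdeal (P : 𝒪 → Set) : Set where
  field
    isIdeal : IsIdeal P
    proper  : ¬ P 1𝒪
    prime   : ∀ x y → P (x ⊗ y) → P x ⊎ P y

-- P lies above 5 : P ∩ ℤ = 5ℤ, equivalently 5 ∈ P (for a prime ideal)
LiesAbove5 : (𝒪 → Set) → Set
LiesAbove5 P = P ⟦ + 5 ⟧

{-# OPTIONS --safe #-}
-- Since ω − ω̄ = √5, the difference φ₁(a,b) − φ₂(a,b) equals √5·ab, so a prime P containing
-- both values contains √5 (and then 5 = √5²) or one of a, b. If P contains a, it contains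
-- φ₁(a,b) − (a + ωb)a = b², hence b; symmetrically. But a and b are coprime integers, so by
-- Bézout P would contain 1.
module Submission where

open import Defs
open import Algebra.Bundles using (CommutativeRing)
import Algebra.Properties.Ring as RingProperties
open import Data.Empty using (⊥-elim)
open import Data.Integer as Int using (ℤ; +_; ∣_∣)
open import Data.Integer.Coprimality using (Coprime)
open import Data.Integer.Properties
  using (+-assoc; +-comm; +-identityˡ; +-identityʳ; +-inverseˡ; +-inverseʳ;
         +∣i∣≡i⊎+∣i∣≡-i; pos-+; pos-*)
open import Data.Integer.Tactic.RingSolver using (solve-∀)
open import Data.Maybe using (Maybe; just; nothing)
import Data.Nat as ℕ
open import Data.Nat.Coprimality using (coprime-Bézout)
open import Data.Nat.GCD using (module Bézout)
open import Data.Product using (_×_; _,_; uncurry)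
open import Data.Sum using (_⊎_; inj₁; inj₂; map₂; fromInj₁)
open import Function using (_∘_)
open import Relation.Binary.PropositionalEquality
open import Algebra.Structures {A = 𝒪} _≡_ using (IsCommutativeRing)
open import Tactic.RingSolver.Core.AlmostCommutativeRing
  using (AlmostCommutativeRing; fromCommutativeRing)

⊕-assoc : ∀ x y z → (x ⊕ y) ⊕ z ≡ x ⊕ (y ⊕ z)
⊕-assoc (x₁ + y₁ ω) (x₂ + y₂ ω) (x₃ + y₃ ω) =
  cong₂ _+_ω (+-assoc x₁ x₂ x₃) (+-assoc y₁ y₂ y₃)

⊕-comm : ∀ x y → x ⊕ y ≡ y ⊕ x
⊕-comm (x₁ + y₁ ω) (x₂ + y₂ ω) = cong₂ _+_ω (+-comm x₁ x₂) (+-comm y₁ y₂)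

⊕-identityˡ : ∀ x → 0𝒪 ⊕ x ≡ x
⊕-identityˡ (x + y ω) = cong₂ _+_ω (+-identityˡ x) (+-identityˡ y)

⊕-identityʳ : ∀ x → x ⊕ 0𝒪 ≡ x
⊕-identityʳ (x + y ω) = cong₂ _+_ω (+-identityʳ x) (+-identityʳ y)

⊖-inverseˡ : ∀ x → ⊖ x ⊕ x ≡ 0𝒪
⊖-inverseˡ (x + y ω) = cong₂ _+_ω (+-inverseˡ x) (+-inverseˡ y)

⊖-inverseʳ : ∀ x → x ⊕ ⊖ x ≡ 0𝒪
⊖-inverseʳ (x + y ω) = cong₂ _+_ω (+-inverseʳ x) (+-inverseʳ y)

⊗-comm : ∀ x y → x ⊗ y ≡ y ⊗ x
⊗-comm (x₁ + y₁ ω) (x₂ + y₂ ω) = cong₂ _+_ω (re-comm x₁ y₁ x₂ y₂) (im-comm x₁ y₁ x₂ y₂)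
  where
  open Int using (_+_; _*_; _-_)
  re-comm : ∀ x₁ y₁ x₂ y₂ → x₁ * x₂ + y₁ * y₂ ≡ x₂ * x₁ + y₂ * y₁
  re-comm = solve-∀
  im-comm : ∀ x₁ y₁ x₂ y₂ → x₁ * y₂ + y₁ * x₂ - y₁ * y₂ ≡ x₂ * y₁ + y₂ * x₁ - y₂ * y₁
  im-comm = solve-∀

⊗-assoc : ∀ x y z → (x ⊗ y) ⊗ z ≡ x ⊗ (y ⊗ z)
⊗-assoc (x₁ + y₁ ω) (x₂ + y₂ ω) (x₃ + y₃ ω) =
  cong₂ _+_ω (re-assoc x₁ y₁ x₂ y₂ x₃ y₃) (im-assoc x₁ y₁ x₂ y₂ x₃ y₃)
  where
  open Int using (_+_; _*_; _-_)
  re-assoc : ∀ x₁ y₁ x₂ y₂ x₃ y₃ →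
    (x₁ * x₂ + y₁ * y₂) * x₃ + (x₁ * y₂ + y₁ * x₂ - y₁ * y₂) * y₃ ≡
    x₁ * (x₂ * x₃ + y₂ * y₃) + y₁ * (x₂ * y₃ + y₂ * x₃ - y₂ * y₃)
  re-assoc = solve-∀
  im-assoc : ∀ x₁ y₁ x₂ y₂ x₃ y₃ →
    (x₁ * x₂ + y₁ * y₂) * y₃ + (x₁ * y₂ + y₁ * x₂ - y₁ * y₂) * x₃
      - (x₁ * y₂ + y₁ * x₂ - y₁ * y₂) * y₃ ≡
    x₁ * (x₂ * y₃ + y₂ * x₃ - y₂ * y₃) + y₁ * (x₂ * x₃ + y₂ * y₃)
      - y₁ * (x₂ * y₃ + y₂ * x₃ - y₂ * y₃)
  im-assoc = solve-∀

⊗-identityˡ : ∀ x → 1𝒪 ⊗ x ≡ x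
⊗-identityˡ (x + y ω) = cong₂ _+_ω (re-identity x y) (im-identity x y)
  where
  open Int using (_+_; _*_; _-_)
  re-identity : ∀ x y → + 1 * x + + 0 * y ≡ x
  re-identity = solve-∀
  im-identity : ∀ x y → + 1 * y + + 0 * x - + 0 * y ≡ y
  im-identity = solve-∀

⊗-distribʳ-⊕ : ∀ x y z → (y ⊕ z) ⊗ x ≡ y ⊗ x ⊕ z ⊗ x
⊗-distribʳ-⊕ (x₁ + y₁ ω) (x₂ + y₂ ω) (x₃ + y₃ ω) =
  cong₂ _+_ω (re-distrib x₁ y₁ x₂ y₂ x₃ y₃) (im-distrib x₁ y₁ x₂ y₂ x₃ y₃)
  where
  open Int using (_+_; _*_; _-_)
  re-distrib : ∀ x₁ y₁ x₂ y₂ x₃ y₃ →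
    (x₂ + x₃) * x₁ + (y₂ + y₃) * y₁ ≡ (x₂ * x₁ + y₂ * y₁) + (x₃ * x₁ + y₃ * y₁)
  re-distrib = solve-∀
  im-distrib : ∀ x₁ y₁ x₂ y₂ x₃ y₃ →
    (x₂ + x₃) * y₁ + (y₂ + y₃) * x₁ - (y₂ + y₃) * y₁ ≡
    (x₂ * y₁ + y₂ * x₁ - y₂ * y₁) + (x₃ * y₁ + y₃ * x₁ - y₃ * y₁)
  im-distrib = solve-∀

⊗-distribˡ-⊕ : ∀ x y z → x ⊗ (y ⊕ z) ≡ x ⊗ y ⊕ x ⊗ z
⊗-distribˡ-⊕ x y z = begin
  x ⊗ (y ⊕ z)     ≡⟨ ⊗-comm x (y ⊕ z) ⟩
  (y ⊕ z) ⊗ x     ≡⟨ ⊗-distribʳ-⊕ x y z ⟩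
  y ⊗ x ⊕ z ⊗ x   ≡⟨ cong₂ _⊕_ (⊗-comm y x) (⊗-comm z x) ⟩
  x ⊗ y ⊕ x ⊗ z   ∎
  where open ≡-Reasoning

⊗-identityʳ : ∀ x → x ⊗ 1𝒪 ≡ x
⊗-identityʳ x = trans (⊗-comm x 1𝒪) (⊗-identityˡ x)

𝒪-isCommutativeRing : IsCommutativeRing _⊕_ _⊗_ ⊖_ 0𝒪 1𝒪
𝒪-isCommutativeRing = record
  { isRing = record
    { +-isAbelianGroup = record
      { isGroup = record
        { isMonoid = record
          { isSemigroup = record
            { isMagma = record { isEquivalence = isEquivalence ; ∙-cong = cong₂ _⊕_ }
            ; assoc = ⊕-assoc }
          ; identity = ⊕-identityˡ , ⊕-identityʳ }
        ; inverse = ⊖-inverseˡ , ⊖-inverseʳ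
        ; ⁻¹-cong = cong ⊖_ }
      ; comm = ⊕-comm }
    ; *-cong = cong₂ _⊗_
    ; *-assoc = ⊗-assoc
    ; *-identity = ⊗-identityˡ , ⊗-identityʳ
    ; distrib = ⊗-distribˡ-⊕ , ⊗-distribʳ-⊕ }
  ; *-comm = ⊗-comm }

𝒪-commutativeRing : CommutativeRing _ _
𝒪-commutativeRing = record { isCommutativeRing = 𝒪-isCommutativeRing }

0𝒪≟_ : ∀ x → Maybe (0𝒪 ≡ x)
0𝒪≟ ((+ 0) + (+ 0) ω) = just refl
0𝒪≟ _                 = nothing

𝒪-almostCommutativeRing : AlmostCommutativeRing _ _
𝒪-almostCommutativeRing = fromCommutativeRing 𝒪-commutativeRing 0𝒪≟_

quadForm : 𝒪 → 𝒪 → 𝒪 → 𝒪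
quadForm c x y = x ⊗ x ⊕ c ⊗ x ⊗ y ⊕ y ⊗ y

module _ where
  open import Tactic.RingSolver.NonReflective 𝒪-almostCommutativeRing
    using (solve; _⊜_) renaming (_⊕_ to _:+_; _⊗_ to _:*_; ⊝_ to :-_)

  quadForm-sub : ∀ c d x y → quadForm c x y ⊕ ⊖ quadForm d x y ≡ (c ⊕ ⊖ d) ⊗ (x ⊗ y)
  quadForm-sub = solve 4 (λ c d x y →
    (x :* x :+ c :* x :* y :+ y :* y) :+ :- (x :* x :+ d :* x :* y :+ y :* y)
      ⊜ (c :+ :- d) :* (x :* y)) refl

  quadForm-sym : ∀ c x y → quadForm c x y ≡ quadForm c y x
  quadForm-sym = solve 3 (λ c x y →
    (x :* x :+ c :* x :* y :+ y :* y) ⊜ (y :* y :+ c :* y :* x :+ x :* x)) refl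

  quadForm-sub-multiple : ∀ c x y → quadForm c x y ⊕ ⊖ ((x ⊕ c ⊗ y) ⊗ x) ≡ y ⊗ y
  quadForm-sub-multiple = solve 3 (λ c x y →
    (x :* x :+ c :* x :* y :+ y :* y) :+ :- ((x :+ c :* y) :* x) ⊜ y :* y) refl

⟦⟧-* : ∀ i j → ⟦ i Int.* j ⟧ ≡ ⟦ i ⟧ ⊗ ⟦ j ⟧
⟦⟧-* i j = cong₂ _+_ω (re-* i j) (im-* i j)
  where
  open Int using (_+_; _*_; _-_)
  re-* : ∀ i j → i * j ≡ i * j + + 0 * + 0
  re-* = solve-∀
  im-* : ∀ i j → + 0 ≡ i * + 0 + + 0 * j - + 0 * + 0
  im-* = solve-∀

module IdealProperties {P : 𝒪 → Set} (isIdeal : IsIdeal P) where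
  open IsIdeal isIdeal

  ⊖-mem : ∀ {x} → P x → P (⊖ x)
  ⊖-mem {x} x∈P = subst P (-1*x≈-x x) (mul-mem (⊖ 1𝒪) x∈P)
    where open RingProperties (CommutativeRing.ring 𝒪-commutativeRing)

  sub-mem : ∀ {x y} → P x → P y → P (x ⊕ ⊖ y)
  sub-mem x∈P y∈P = add-mem x∈P (⊖-mem y∈P)

  ∣∣-mem : ∀ i → P ⟦ i ⟧ → P ⟦ + ∣ i ∣ ⟧
  ∣∣-mem i i∈P with +∣i∣≡i⊎+∣i∣≡-i i
  ... | inj₁ eq = subst (P ∘ ⟦_⟧) (sym eq) i∈P
  ... | inj₂ eq = subst (P ∘ ⟦_⟧) (sym eq) (⊖-mem i∈P)

  *-mem : ∀ k {m} → P ⟦ + m ⟧ → P ⟦ + (k ℕ.* m) ⟧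
  *-mem k {m} m∈P =
    subst P (sym (trans (cong ⟦_⟧ (pos-* k m)) (⟦⟧-* (+ k) (+ m)))) (mul-mem ⟦ + k ⟧ m∈P)

  bézout-mem : ∀ {m n} x y → 1 ℕ.+ y ℕ.* n ≡ x ℕ.* m → P ⟦ + m ⟧ → P ⟦ + n ⟧ → P 1𝒪
  bézout-mem {m} {n} x y eq m∈P n∈P =
    subst (P ∘ ⟦_⟧) xm-yn≡1 (sub-mem (*-mem x m∈P) (*-mem y n∈P))
    where
    open Int using (_+_; _-_)
    +-sub-cancel : ∀ i j → i + j - j ≡ i
    +-sub-cancel = solve-∀
    xm-yn≡1 : + (x ℕ.* m) - + (y ℕ.* n) ≡ + 1
    xm-yn≡1 = begin
      + (x ℕ.* m) - + (y ℕ.* n)         ≡⟨ cong (λ k → + k - + (y ℕ.* n)) eq ⟨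
      + (1 ℕ.+ y ℕ.* n) - + (y ℕ.* n)   ≡⟨ cong (_- + (y ℕ.* n)) (pos-+ 1 (y ℕ.* n)) ⟩
      + 1 + + (y ℕ.* n) - + (y ℕ.* n)   ≡⟨ +-sub-cancel (+ 1) (+ (y ℕ.* n)) ⟩
      + 1                               ∎
      where open ≡-Reasoning

  coprime-mem⇒1-mem : ∀ {a b} → Coprime a b → P ⟦ a ⟧ → P ⟦ b ⟧ → P 1𝒪
  coprime-mem⇒1-mem {a} {b} coprime a∈P b∈P with coprime-Bézout coprime
  ... | Bézout.+- x y eq = bézout-mem x y eq (∣∣-mem a a∈P) (∣∣-mem b b∈P)
  ... | Bézout.-+ x y eq = bézout-mem y x eq (∣∣-mem b b∈P) (∣∣-mem a a∈P)

module PrimeIdealProperties {P : 𝒪 → Set} (isPrimeIdeal : IsPrimeIdeal P) where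
  open IsPrimeIdeal isPrimeIdeal
  open IsIdeal isIdeal
  open IdealProperties isIdeal

  square-mem⇒mem : ∀ {x} → P (x ⊗ x) → P x
  square-mem⇒mem {x} x²∈P with prime x x x²∈P
  ... | inj₁ x∈P = x∈P
  ... | inj₂ x∈P = x∈P

  quadForm-mem : ∀ c {x y} → P (quadForm c x y) → P x → P y
  quadForm-mem c {x} {y} q∈P x∈P = square-mem⇒mem
    (subst P (quadForm-sub-multiple c x y) (sub-mem q∈P (mul-mem (x ⊕ c ⊗ y) x∈P)))

  quadForm-product-mem : ∀ c {x y} → P (quadForm c x y) → P (x ⊗ y) → P x × P y
  quadForm-product-mem c {x} {y} q∈P xy∈P with prime x y xy∈P
  ... | inj₁ x∈P = x∈P , quadForm-mem c q∈P x∈P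
  ... | inj₂ y∈P = quadForm-mem c (subst P (quadForm-sym c x y) q∈P) y∈P , y∈P

  quadForm-sub-mem : ∀ c d {x y} → P (quadForm c x y) → P (quadForm d x y) →
    P (c ⊕ ⊖ d) ⊎ (P x × P y)
  quadForm-sub-mem c d {x} {y} qc∈P qd∈P = map₂ (quadForm-product-mem c qc∈P)
    (prime (c ⊕ ⊖ d) (x ⊗ y) (subst P (quadForm-sub c d x y) (sub-mem qc∈P qd∈P)))

  quadForm-coprime-mem : ∀ c d a b → Coprime a b →
    P (quadForm c ⟦ a ⟧ ⟦ b ⟧) → P (quadForm d ⟦ a ⟧ ⟦ b ⟧) → P (c ⊕ ⊖ d)
  quadForm-coprime-mem c d a b coprime qc∈P qd∈P =
    fromInj₁ (⊥-elim ∘ proper ∘ uncurry (coprime-mem⇒1-mem {a} {b} coprime))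
             (quadForm-sub-mem c d qc∈P qd∈P)

√5 : 𝒪
√5 = ω ⊕ ⊖ ω̄

√5*√5≡5 : √5 ⊗ √5 ≡ ⟦ + 5 ⟧
√5*√5≡5 = refl

proposition1 : (a b : ℤ) → Coprime a b →
    (P : 𝒪 → Set) → IsPrimeIdeal P →
    P (φ₁ a b) → P (φ₂ a b) → LiesAbove5 P
proposition1 a b coprime P isPrimeIdeal φ₁∈P φ₂∈P =
  subst P √5*√5≡5 (mul-mem √5 (quadForm-coprime-mem ω ω̄ a b coprime φ₁∈P φ₂∈P))
  where
  open PrimeIdealProperties isPrimeIdeal
  open IsIdeal (IsPrimeIdeal.isIdeal isPrimeIdeal)
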